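{- For every natural number $n>2$, $$\sum_{i=2}^{n}\sum_{j=1}^{i-1}\binom{n-i+j-1}{j-1}\binom{n+i-j-1}{i-1}=(n-1)\binom{2n-2}{n-1}.$$ -}

module Defs where

open import Data.Nat using (ℕ; zero; suc; _+_; _∸_; _≤_)
open import Data.List using (List; []; _∷_; map; upTo)
open import Data.Nat.ListAction using (sum)

-- [ a .. b ] : the list a, a+1, ..., b (empty if b < a)
range : ℕ → ℕ → List ℕ
range a b = map (a +_) (upTo (suc b ∸ a))

sumRange : ℕ → ℕ → (ℕ → ℕ) → ℕ
sumRange a b f = sum (map f (range a b))

module Submission where

-- Write n = m + 1, i = x + 2 and j = y + 1, so that 0 ≤ y ≤ x < m.  The
-- summand depends only on y and on the diagonal index t = x - y:
--
--     C(n-i+j-1, j-1) · C(n+i-j-1, i-1)  =  C(m-1-t, y) · C(m+1+t, y+t+1).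
--
-- Regrouping the triangle y ≤ x < m by diagonals, the sum over y for a fixed
-- t < m is an instance of Vandermonde's identity
--
--     Σ_y C(p, y) · C(q, r+y)  =  C(p+q, p+r)
--
-- with p = m-1-t, q = m+1+t, r = t+1, whose value C(2m, m) does not depend
-- on t.  Hence the double sum is m · C(2m, m) = (n-1) · C(2n-2, n-1).

open import Defs
open import Data.Nat using (ℕ; _+_; _*_; _∸_; _<_)
open import Data.Nat.Combinatorics using (_C_)
open import Relation.Binary.PropositionalEquality using (_≡_)

open import Data.Nat using (zero; suc; _≤_; z≤n; s≤s)
open import Data.Nat.Properties
open import Data.Nat.Combinatorics using (nCk+nC[k+1]≡[n+1]C[k+1])
open import Data.Nat.ListAction using (sum)
open import Data.List using (map; applyUpTo)
open import Data.List.Properties using (map-∘; map-applyUpTo)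
open import Algebra.Properties.CommutativeSemigroup +-commutativeSemigroup
  using (x∙yz≈y∙xz)
open import Relation.Binary.PropositionalEquality
  using (refl; sym; trans; cong; cong₂; subst; module ≡-Reasoning)
open ≡-Reasoning

-- ∑[ x < k ] f x  =  f 0 + f 1 + … + f (k - 1); the recursion peels off the
-- first term, so shifting the index by one is definitional.
∑< : ℕ → (ℕ → ℕ) → ℕ
∑< zero    f = 0
∑< (suc k) f = f 0 + ∑< k (λ x → f (suc x))

syntax ∑< k (λ x → e) = ∑[ x < k ] e

∑-cong : ∀ k {f g : ℕ → ℕ} → (∀ x → x < k → f x ≡ g x) → ∑< k f ≡ ∑< k g
∑-cong zero    eq = refl
∑-cong (suc k) eq =
  cong₂ _+_ (eq 0 (s≤s z≤n)) (∑-cong k (λ x x<k → eq (suc x) (s≤s x<k)))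

∑-snoc : ∀ k (f : ℕ → ℕ) → ∑< (suc k) f ≡ ∑< k f + f k
∑-snoc zero    f = +-comm (f 0) 0
∑-snoc (suc k) f = begin
  f 0 + ∑< (suc k) (λ x → f (suc x))       ≡⟨ cong (f 0 +_) (∑-snoc k (λ x → f (suc x))) ⟩
  f 0 + (∑< k (λ x → f (suc x)) + f (suc k)) ≡⟨ +-assoc (f 0) _ _ ⟨
  f 0 + ∑< k (λ x → f (suc x)) + f (suc k)   ∎

∑-+ : ∀ k (f g : ℕ → ℕ) → ∑[ x < k ] (f x + g x) ≡ ∑< k f + ∑< k g
∑-+ zero    f g = refl
∑-+ (suc k) f g = begin
  (f 0 + g 0) + ∑[ x < k ] (f (suc x) + g (suc x))  ≡⟨ cong ((f 0 + g 0) +_) (∑-+ k _ _) ⟩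
  (f 0 + g 0) + (F + G)                           ≡⟨ +-assoc (f 0) (g 0) _ ⟩
  f 0 + (g 0 + (F + G))                           ≡⟨ cong (f 0 +_) (x∙yz≈y∙xz (g 0) F G) ⟩
  f 0 + (F + (g 0 + G))                           ≡⟨ +-assoc (f 0) F _ ⟨
  (f 0 + F) + (g 0 + G)                           ∎
  where
  F = ∑< k (λ x → f (suc x))
  G = ∑< k (λ x → g (suc x))

∑-const : ∀ k c → ∑[ x < k ] c ≡ k * c
∑-const zero    c = refl
∑-const (suc k) c = cong (c +_) (∑-const k c)

sum-applyUpTo : ∀ (f : ℕ → ℕ) k → sum (applyUpTo f k) ≡ ∑< k f
sum-applyUpTo f zero    = refl
sum-applyUpTo f (suc k) = cong (f 0 +_) (sum-applyUpTo (λ x → f (suc x)) k)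

sumRange-as-∑ : ∀ a b f → sumRange a b f ≡ ∑[ x < suc b ∸ a ] f (a + x)
sumRange-as-∑ a b f = begin
  sum (map f (map (a +_) (applyUpTo (λ x → x) k)))
    ≡⟨ cong sum (map-∘ (applyUpTo (λ x → x) k)) ⟨
  sum (map (λ x → f (a + x)) (applyUpTo (λ x → x) k))
    ≡⟨ cong sum (map-applyUpTo (λ x → x) (λ x → f (a + x)) k) ⟩
  sum (applyUpTo (λ x → f (a + x)) k)
    ≡⟨ sum-applyUpTo (λ x → f (a + x)) k ⟩
  ∑[ x < k ] f (a + x) ∎
  where
  k = suc b ∸ a

-- Pascal's rule applied termwise: weighting a sequence c by row p+1 of
-- Pascal's triangle is weighting it by row p, once shifted and once not.
∑-pascal : ∀ p N (c : ℕ → ℕ) →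
  ∑[ y < suc N ] ((suc p C y) * c y)
    ≡ ∑[ y < N ] ((p C y) * c (suc y)) + ∑[ y < suc N ] ((p C y) * c y)
∑-pascal p N c = begin
  1 * c 0 + ∑[ y < N ] ((suc p C suc y) * c (suc y))
    ≡⟨ cong (1 * c 0 +_) (∑-cong N (λ y _ → pascal-term y)) ⟩
  1 * c 0 + ∑[ y < N ] ((p C y) * c (suc y) + (p C suc y) * c (suc y))
    ≡⟨ cong (1 * c 0 +_) (∑-+ N (λ y → (p C y) * c (suc y)) (λ y → (p C suc y) * c (suc y))) ⟩
  1 * c 0 + (Shifted + Unshifted)
    ≡⟨ x∙yz≈y∙xz (1 * c 0) Shifted Unshifted ⟩
  Shifted + (1 * c 0 + Unshifted) ∎
  where
  -- The y = 0 terms are 1 * c 0 on both sides, as C(p+1, 0) and C(p, 0)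
  -- compute to 1; the remaining terms are grouped into these two sums.
  Shifted Unshifted : ℕ
  Shifted   = ∑[ y < N ] ((p C y) * c (suc y))
  Unshifted = ∑[ y < N ] ((p C suc y) * c (suc y))

  pascal-term : ∀ y → (suc p C suc y) * c (suc y) ≡ (p C y) * c (suc y) + (p C suc y) * c (suc y)
  pascal-term y = begin
    (suc p C suc y) * c (suc y)           ≡⟨ cong (_* c (suc y)) (nCk+nC[k+1]≡[n+1]C[k+1] p y) ⟨
    (p C y + p C suc y) * c (suc y)       ≡⟨ *-distribʳ-+ (c (suc y)) (p C y) _ ⟩
    (p C y) * c (suc y) + (p C suc y) * c (suc y) ∎

-- Vandermonde's identity.  The terms with y > p vanish, so any number N > p
-- of terms may be summed; this freedom is what makes the induction on p work.
vandermonde : ∀ p q r N → p < N → ∑[ y < N ] ((p C y) * (q C (r + y))) ≡ (p + q) C (p + r)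
-- For p = 0 only the term y = 0 survives, since C(0, y + 1) computes to 0.
vandermonde zero q r (suc N) _ = begin
  1 * (q C (r + 0)) + ∑[ y < N ] 0 ≡⟨ cong₂ _+_ (*-identityˡ _) (∑-const N 0) ⟩
  q C (r + 0) + N * 0             ≡⟨ cong₂ (λ k l → q C k + l) (+-identityʳ r) (*-zeroʳ N) ⟩
  q C r + 0                       ≡⟨ +-identityʳ _ ⟩
  q C r                           ∎
vandermonde (suc p) q r (suc N) (s≤s p<N) = begin
  ∑[ y < suc N ] ((suc p C y) * (q C (r + y)))
    ≡⟨ ∑-pascal p N (λ y → q C (r + y)) ⟩
  ∑[ y < N ] ((p C y) * (q C (r + suc y))) + ∑[ y < suc N ] ((p C y) * (q C (r + y)))
    ≡⟨ cong (_+ ∑[ y < suc N ] ((p C y) * (q C (r + y))))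
            (∑-cong N (λ y _ → cong (λ k → (p C y) * (q C k)) (+-suc r y))) ⟩
  ∑[ y < N ] ((p C y) * (q C (suc r + y))) + ∑[ y < suc N ] ((p C y) * (q C (r + y)))
    ≡⟨ cong₂ _+_ (vandermonde p q (suc r) N p<N) (vandermonde p q r (suc N) (m<n⇒m<1+n p<N)) ⟩
  (p + q) C (p + suc r) + (p + q) C (p + r)
    ≡⟨ cong (λ k → (p + q) C k + (p + q) C (p + r)) (+-suc p r) ⟩
  (p + q) C suc (p + r) + (p + q) C (p + r)
    ≡⟨ +-comm ((p + q) C suc (p + r)) _ ⟩
  (p + q) C (p + r) + (p + q) C suc (p + r)
    ≡⟨ nCk+nC[k+1]≡[n+1]C[k+1] (p + q) (p + r) ⟩
  suc (p + q) C suc (p + r) ∎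

-- Summing over the pairs y ≤ x < m row by row, or diagonal by diagonal
-- (t = x - y).  Induction on m, splitting off the column y = 0 on both sides.
triangle-by-diagonals : ∀ m (F : ℕ → ℕ → ℕ) →
  ∑[ x < m ] ∑[ y < suc x ] F x y ≡ ∑[ t < m ] ∑[ y < m ∸ t ] F (y + t) y
triangle-by-diagonals zero    F = refl
triangle-by-diagonals (suc m) F = begin
  (F 0 0 + 0) + ∑[ x < m ] (F (suc x) 0 + ∑[ y < suc x ] F (suc x) (suc y))
    ≡⟨ cong₂ _+_ (+-identityʳ (F 0 0))
                 (∑-+ m (λ x → F (suc x) 0) (λ x → ∑[ y < suc x ] F (suc x) (suc y))) ⟩
  F 0 0 + (∑[ x < m ] F (suc x) 0 + ∑[ x < m ] ∑[ y < suc x ] F (suc x) (suc y))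
    ≡⟨ cong (λ s → F 0 0 + (∑[ x < m ] F (suc x) 0 + s))
            (triangle-by-diagonals m (λ x y → F (suc x) (suc y))) ⟩
  F 0 0 + (∑[ x < m ] F (suc x) 0 + Diagonals m)
    ≡⟨ +-assoc (F 0 0) _ _ ⟨
  ∑[ t < suc m ] F t 0 + Diagonals m
    ≡⟨ cong (∑[ t < suc m ] F t 0 +_) (sym last-diagonal-empty) ⟩
  ∑[ t < suc m ] F t 0 + Diagonals (suc m)
    ≡⟨ ∑-+ (suc m) (λ t → F t 0) (λ t → ∑[ y < m ∸ t ] F (suc y + t) (suc y)) ⟨
  ∑[ t < suc m ] (F t 0 + ∑[ y < m ∸ t ] F (suc y + t) (suc y))
    -- for t ≤ m the diagonal t of the full triangle has (m - t) + 1 terms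
    ≡⟨ ∑-cong (suc m) (λ t t≤m → cong (λ k → ∑[ y < k ] F (y + t) y)
                                       (sym (+-∸-assoc 1 (≤-pred t≤m)))) ⟩
  ∑[ t < suc m ] ∑[ y < suc m ∸ t ] F (y + t) y ∎
  where
  -- The diagonals t < k of the triangle left after removing the column y = 0.
  Diagonals : ℕ → ℕ
  Diagonals k = ∑[ t < k ] ∑[ y < m ∸ t ] F (suc y + t) (suc y)

  last-diagonal-empty : Diagonals (suc m) ≡ Diagonals m
  last-diagonal-empty = begin
    Diagonals (suc m)                                  ≡⟨ ∑-snoc m _ ⟩
    Diagonals m + ∑[ y < m ∸ m ] F (suc y + m) (suc y)
      ≡⟨ cong (λ k → Diagonals m + ∑[ y < k ] F (suc y + m) (suc y)) (n∸n≡0 m) ⟩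
    Diagonals m + 0 ≡⟨ +-identityʳ _ ⟩
    Diagonals m     ∎

summand : ℕ → ℕ → ℕ → ℕ
summand n i j = (((n ∸ i + j) ∸ 1) C (j ∸ 1)) * (((n + i ∸ j) ∸ 1) C (i ∸ 1))

-- On the diagonal i - j = t + 1 (with n = m + 1, j = y + 1) the summand is a
-- term of Vandermonde's identity with p = m-1-t, q = m+1+t, r = t+1.
summand-on-diagonal : ∀ m t y → y < m ∸ t →
  summand (suc m) (2 + (y + t)) (1 + y) ≡ ((m ∸ suc t) C y) * ((m + suc t) C (suc t + y))
summand-on-diagonal m t y y<m∸t = begin
  summand (suc m) (2 + (y + t)) (1 + y)
    ≡⟨ cong₂ (λ a b → (a C y) * (b C suc (y + t))) first-top second-top ⟩
  ((m ∸ suc t) C y) * ((m + suc t) C suc (y + t))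
    ≡⟨ cong (λ k → ((m ∸ suc t) C y) * ((m + suc t) C suc k)) (+-comm y t) ⟩
  ((m ∸ suc t) C y) * ((m + suc t) C (suc t + y)) ∎
  where
  y≤m∸1+t : y ≤ m ∸ suc t
  y≤m∸1+t = subst (y ≤_) (pred[m∸n]≡m∸[1+n] m t) (<⇒≤pred y<m∸t)

  -- n - i + j - 1 = m - 1 - t, using y ≤ m - 1 - t to cancel the truncations.
  first-top : (m ∸ suc (y + t) + suc y) ∸ 1 ≡ m ∸ suc t
  first-top = begin
    (m ∸ suc (y + t) + suc y) ∸ 1 ≡⟨ cong (_∸ 1) (+-suc _ y) ⟩
    m ∸ suc (y + t) + y           ≡⟨ cong (λ k → m ∸ suc k + y) (+-comm y t) ⟩
    m ∸ (suc t + y) + y           ≡⟨ cong (_+ y) (∸-+-assoc m (suc t) y) ⟨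
    m ∸ suc t ∸ y + y             ≡⟨ m∸n+n≡m y≤m∸1+t ⟩
    m ∸ suc t                     ∎

  second-top : (suc m + (2 + (y + t)) ∸ (1 + y)) ∸ 1 ≡ m + suc t
  second-top = begin
    (suc m + (2 + (y + t)) ∸ (1 + y)) ∸ 1 ≡⟨ cong (_∸ 1) (+-∸-assoc (suc m) 1+y≤2+y+t) ⟩
    (suc m + (suc (y + t) ∸ y)) ∸ 1       ≡⟨ cong (λ k → (suc m + (k ∸ y)) ∸ 1) (sym (+-suc y t)) ⟩
    (suc m + (y + suc t ∸ y)) ∸ 1         ≡⟨ cong (λ k → (suc m + k) ∸ 1) (m+n∸m≡n y (suc t)) ⟩
    m + suc t                             ∎
    where
    1+y≤2+y+t : 1 + y ≤ 2 + (y + t)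
    1+y≤2+y+t = s≤s (m≤n⇒m≤1+n (m≤m+n y t))

diagonal-sum : ∀ m t → t < m →
  ∑[ y < m ∸ t ] (((m ∸ suc t) C y) * ((m + suc t) C (suc t + y))) ≡ (m + m) C m
diagonal-sum m t t<m = begin
  ∑[ y < m ∸ t ] ((p C y) * (q C (suc t + y))) ≡⟨ vandermonde p q (suc t) (m ∸ t) p<m∸t ⟩
  (p + q) C (p + suc t)                         ≡⟨ cong₂ _C_ p+q≡m+m p+1+t≡m ⟩
  (m + m) C m                                   ∎
  where
  p = m ∸ suc t
  q = m + suc t

  p+1+t≡m : p + suc t ≡ m
  p+1+t≡m = m∸n+n≡m t<m

  p<m∸t : p < m ∸ t
  p<m∸t = subst (p <_) (sym (+-∸-assoc 1 t<m)) (n<1+n p)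

  p+q≡m+m : p + q ≡ m + m
  p+q≡m+m = trans (x∙yz≈y∙xz p m (suc t)) (cong (m +_) p+1+t≡m)

2[1+m]∸2≡m+m : ∀ m → 2 * suc m ∸ 2 ≡ m + m
2[1+m]∸2≡m+m m = begin
  2 * suc m ∸ 2   ≡⟨ cong (_∸ 2) (*-suc 2 m) ⟩
  2 + 2 * m ∸ 2   ≡⟨⟩
  m + (m + 0)     ≡⟨ cong (m +_) (+-identityʳ m) ⟩
  m + m           ∎

lemma11 : (n : ℕ) → 2 < n →
    sumRange 2 n (λ i → sumRange 1 (i ∸ 1) (λ j → (((n ∸ i + j) ∸ 1) C (j ∸ 1)) * (((n + i ∸ j) ∸ 1) C (i ∸ 1))))
      ≡ (n ∸ 1) * ((2 * n ∸ 2) C (n ∸ 1))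
-- Write n = m + 1 and follow the outline at the top of the file.
lemma11 (suc m) _ = begin
  sumRange 2 (suc m) (λ i → sumRange 1 (i ∸ 1) (summand (suc m) i))
    ≡⟨ sumRange-as-∑ 2 (suc m) _ ⟩
  ∑[ x < m ] sumRange 1 (suc x) (summand (suc m) (2 + x))
    ≡⟨ ∑-cong m (λ x _ → sumRange-as-∑ 1 (suc x) _) ⟩
  ∑[ x < m ] ∑[ y < suc x ] summand (suc m) (2 + x) (1 + y)
    ≡⟨ triangle-by-diagonals m (λ x y → summand (suc m) (2 + x) (1 + y)) ⟩
  ∑[ t < m ] ∑[ y < m ∸ t ] summand (suc m) (2 + (y + t)) (1 + y)
    ≡⟨ ∑-cong m (λ t t<m → trans (∑-cong (m ∸ t) (summand-on-diagonal m t))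
                                 (diagonal-sum m t t<m)) ⟩
  ∑[ t < m ] ((m + m) C m)
    ≡⟨ ∑-const m _ ⟩
  m * ((m + m) C m)
    ≡⟨ cong (λ k → m * (k C m)) (2[1+m]∸2≡m+m m) ⟨
  m * ((2 * suc m ∸ 2) C m) ∎
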